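{- Let $(G=(V,E),w,c,B)$ be an instance of the Bounded Cost Minimum Diameter Edge Addition problem, and let $C\subseteq V$ be a set of $B+1$ vertices such that $\mathrm{dist}_G(v,C)\le D^B_{opt}$ for every $v\in V$. Let $u\in V$ and let $G'_B$ be a $B$-augmentation of $G$ having a Shortest Path Tree of $G'_B$, $C$ and $u$ whose height equals the height of a Minimum Height$_B$ SPT of $G$, $C$ and $u$. Then the diameter of $G'_B$ is at most $4\cdot D^B_{opt}$.
   Context: Bounded Cost Minimum Diameter Edge Addition: input is an undirected graph $G=(V,E)$, a weight function $w:[V]^2\to\mathbb{N}$, a cost function $c:[V]^2\to\mathbb{N}^*$ (where $[V]^2$ is the set of unordered vertex pairs) and an integer $B$; a $B$-augmentation of $G$ is a graph $(V,E\cup F)$ (with weights $w$) where $F$ is a set of non-edges of $G$ with $\sum_{e\in F}c(e)\le B$. Distances $\mathrm{dist}_G(u,v)=d_G(u,v)$ are minimum path weights, $\mathrm{dist}_G(v,C)=\min_{x\in C}\mathrm{dist}_G(v,x)$; the diameter is the largest distance; $D^B_{opt}$ is the minimum diameter over all $B$-augmentations of $G$. A Shortest Path Tree of a graph $G'=(V,E')$, a set $C\subseteq V$ and a vertex $u$ is a tree $T$ rooted at $u$, spanning $C$, whose vertices and edges belong to $V$ and $E'$, such that $d_T(u,x)=d_{G'}(u,x)$ for every $x\in C$. The height of a weighted rooted tree is the maximum weight of a path from the root to a leaf. A Minimum Height$_B$ SPT of $G$, $C$ and $u$ is a Shortest Path Tree of $G_B$, $C$ and $u$ of minimum height over all $B$-augmentations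 $G_B$ of $G$. -}

module Defs where

open import Data.Nat using (ℕ; zero; suc; _+_; _*_; _≤_; _<ᵇ_; _⊔_)
open import Data.Bool using (Bool; true; false; _∧_; _∨_; if_then_else_)
open import Data.Fin using (Fin; toℕ)
open import Data.Fin.Subset using (Subset; _∈_)
open import Data.List using (List; []; _∷_; map; allFin; _++_)
open import Data.Nat.ListAction using (sum)
open import Data.List.Membership.Propositional renaming (_∈_ to _∈ₗ_)
open import Data.List.Relation.Unary.Unique.Propositional using (Unique)
open import Data.Product using (Σ; ∃; _×_; _,_; proj₁; proj₂)
open import Relation.Binary.PropositionalEquality using (_≡_; _≢_)

-- Vertex set V = Fin n.  A graph (or any set of unordered pairs) is a
-- symmetric Bool-valued adjacency matrix.
Graph : ℕ → Set
Graph n = Fin n → Fin n → Bool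

-- Functions on [V]^2 (weights, costs), represented as symmetric matrices.
PairFun : ℕ → Set
PairFun n = Fin n → Fin n → ℕ

SymmetricPF : ∀ {n} → PairFun n → Set
SymmetricPF {n} f = ∀ (i j : Fin n) → f i j ≡ f j i

IsUndirected : ∀ {n} → Graph n → Set
IsUndirected {n} E = (∀ (i j : Fin n) → E i j ≡ E j i) × (∀ (i : Fin n) → E i i ≡ false)

IsInstance : ∀ {n} → Graph n → PairFun n → PairFun n → Set
IsInstance {n} E w c =
  IsUndirected E × SymmetricPF w × SymmetricPF c × (∀ (i j : Fin n) → i ≢ j → 1 ≤ c i j)

data Walk {n : ℕ} (w : PairFun n) (A : Graph n) : Fin n → Fin n → ℕ → Set where
  [] : ∀ {x} → Walk w A x x 0
  step : ∀ {x y z k} → A x y ≡ true → Walk w A y z k → Walk w A x z (w x y + k)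

DistLe : ∀ {n} → PairFun n → Graph n → Fin n → Fin n → ℕ → Set
DistLe w A x y d = ∃ λ k → Walk w A x y k × k ≤ d

IsDist : ∀ {n} → PairFun n → Graph n → Fin n → Fin n → ℕ → Set
IsDist w A x y d = Walk w A x y d × (∀ k → Walk w A x y k → d ≤ k)

DistToSetLe : ∀ {n} → PairFun n → Graph n → Fin n → Subset n → ℕ → Set
DistToSetLe w A v C d = ∃ λ x → x ∈ C × DistLe w A v x d

-- diameter of A is ≤ D (all pairwise distances ≤ D; infinite if disconnected)
DiamLe : ∀ {n} → PairFun n → Graph n → ℕ → Set
DiamLe {n} w A D = ∀ (x y : Fin n) → DistLe w A x y D

augment : ∀ {n} → Graph n → Graph n → Graph n
augment E F i j = E i j ∨ F i j

-- cost of F = sum over unordered pairs {i,j} ∈ F (counted once, via i < j) of c(i,j)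
pairCost : ∀ {n} → PairFun n → Graph n → Fin n → Fin n → ℕ
pairCost c F i j = if F i j ∧ (toℕ i <ᵇ toℕ j) then c i j else 0

cost : ∀ {n} → PairFun n → Graph n → ℕ
cost {n} c F = sum (map (λ i → sum (map (pairCost c F i) (allFin n))) (allFin n))

IsBAug : ∀ {n} → Graph n → PairFun n → ℕ → Graph n → Set
IsBAug {n} E c B F =
  (∀ (i j : Fin n) → F i j ≡ F j i) × (∀ (i : Fin n) → F i i ≡ false) ×
  (∀ (i j : Fin n) → F i j ≡ true → E i j ≡ false) × cost c F ≤ B

IsOptDiam : ∀ {n} → Graph n → PairFun n → PairFun n → ℕ → ℕ → Set
IsOptDiam {n} E w c B D =
  (∃ λ (F : Graph n) → IsBAug E c B F × DiamLe w (augment E F) D) ×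
  (∀ (F : Graph n) (D' : ℕ) → IsBAug E c B F → DiamLe w (augment E F) D' → D ≤ D')

data Tree {n : ℕ} (A : Graph n) : Fin n → Set
data Forest {n : ℕ} (A : Graph n) (r : Fin n) : Set

data Tree A where
  node : ∀ r → Forest A r → Tree A r

data Forest A r where
  [] : Forest A r
  cons : ∀ {ch} → A r ch ≡ true → Tree A ch → Forest A r → Forest A r

depthsT : ∀ {n} {A : Graph n} {r} → PairFun n → Tree A r → List (Fin n × ℕ)
depthsF : ∀ {n} {A : Graph n} {r} → PairFun n → Forest A r → List (Fin n × ℕ)
depthsT w (node r f) = (r , 0) ∷ depthsF w f
depthsF w [] = []
depthsF {r = r} w (cons {ch} _ t f) =
  map (λ p → proj₁ p , w r ch + proj₂ p) (depthsT w t) ++ depthsF w f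

heightT : ∀ {n} {A : Graph n} {r} → PairFun n → Tree A r → ℕ
heightF : ∀ {n} {A : Graph n} {r} → PairFun n → Forest A r → ℕ
heightT w (node r f) = heightF w f
heightF w [] = 0
heightF {r = r} w (cons {ch} _ t f) = (w r ch + heightT w t) ⊔ heightF w f

-- T is a Shortest Path Tree of A, C and u: a tree (distinct vertices) rooted
-- at u with edges in A, spanning C, with d_T(u,x) = d_A(u,x) for x ∈ C.
IsSPT : ∀ {n} → PairFun n → (A : Graph n) → Subset n → (u : Fin n) → Tree A u → Set
IsSPT {n} w A C u T =
  Unique (map proj₁ (depthsT w T)) ×
  (∀ (x : Fin n) → x ∈ C → ∃ λ d → (x , d) ∈ₗ depthsT w T × IsDist w A u x d)

IsMinHeightSPT : ∀ {n} → (E : Graph n) → PairFun n → PairFun n → ℕ → Subset n → (u : Fin n) →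
                 (F : Graph n) → Tree (augment E F) u → Set
IsMinHeightSPT {n} E w c B C u F T =
  IsBAug E c B F × IsSPT w (augment E F) C u T ×
  (∀ (F' : Graph n) (T' : Tree (augment E F') u) →
     IsBAug E c B F' → IsSPT w (augment E F') C u T' → heightT w T ≤ heightT w T')

module Submission where

-- Let F* be an optimal B-augmentation, of diameter D.  Every vertex lies within D of u
-- in G ∪ F*, so grafting geodesics from u one after another yields a shortest path tree
-- of G ∪ F*, C and u of height at most D; by minimality the given tree T has height at
-- most D as well.  Now every vertex x is within D of some c ∈ C in G, and c is within
-- height T ≤ D of u in G ∪ F, so every vertex is within 2D of the hub u, and any two
-- vertices are within 4D of each other.

open import Defs
open import Data.Nat using (ℕ; zero; suc; _+_; _*_; _∸_; _≤_; _<_; z≤n; s≤s)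
open import Data.Nat.Properties
open import Data.Bool using (true)
import Data.Bool.Properties as Bool
open import Data.Fin using (Fin; zero; suc)
open import Data.Fin.Subset using (Subset; ∣_∣) renaming (_∈_ to _∈ˢ_)
open import Data.Fin.Properties using (any?; injective⇒≤) renaming (_≟_ to _≟ᶠ_)
open import Data.List using (List; []; _∷_; map; length; lookup; allFin; _++_)
open import Data.List.Relation.Unary.All as All using ([])
open import Data.List.Relation.Unary.All.Properties using (¬Any⇒All¬)
open import Data.List.Relation.Unary.Any using (here; there)
open import Data.List.Relation.Unary.AllPairs using ([]; _∷_)
open import Data.List.Relation.Unary.Unique.Propositional using (Unique)
open import Data.List.Membership.Propositional using (_∈_; _∉_)
open import Data.List.Relation.Binary.Subset.Propositional using (_⊆_)
open import Data.List.Relation.Binary.Subset.Propositional.Properties using (⊆-refl; ⊆-trans)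
open import Data.List.Membership.Propositional.Properties using (∈-lookup; ∈-allFin; ∈-map⁺; ∈-map⁻; ∈-++⁺ˡ; ∈-++⁺ʳ; ∈-++⁻)
open import Data.List.Relation.Binary.Permutation.Propositional using (_↭_; ↭-refl; ↭-reflexive; ↭-trans; ↭-sym; prep; swap; ↭⇒↭ₛ)
open import Data.List.Relation.Binary.Permutation.Propositional.Properties using (∈-resp-↭; ++⁺ˡ; ++⁺ʳ; shift) renaming (map⁺ to ↭-map⁺)
open import Data.List.Relation.Binary.Permutation.Setoid.Properties using (Unique-resp-↭)
import Data.List.Membership.DecPropositional as DecMembership
open import Data.Product using (Σ; ∃; _×_; _,_; proj₁; proj₂)
open import Data.Sum using (_⊎_; inj₁; inj₂)
open import Data.Empty using (⊥-elim)
open import Relation.Nullary using (Dec; yes; no; ¬_)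
open import Relation.Nullary.Decidable using (_×-dec_)
open import Relation.Unary using (Decidable)
open import Relation.Binary.PropositionalEquality using (_≡_; _≢_; refl; sym; trans; cong; subst; setoid)

private
  variable
    n k l d : ℕ
    w : PairFun n
    A A′ : Graph n
    x y z u p : Fin n

Unique-lookup-injective : {X : Set} {xs : List X} → Unique xs →
                          ∀ {i j} → lookup xs i ≡ lookup xs j → i ≡ j
Unique-lookup-injective (_ ∷ _) {zero} {zero} _ = refl
Unique-lookup-injective (x∉ ∷ _) {zero} {suc j} eq = ⊥-elim (All.lookup x∉ (∈-lookup j) eq)
Unique-lookup-injective (x∉ ∷ _) {suc i} {zero} eq = ⊥-elim (All.lookup x∉ (∈-lookup i) (sym eq))
Unique-lookup-injective (_ ∷ xs-unique) {suc i} {suc j} eq = cong suc (Unique-lookup-injective xs-unique eq)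

Unique⇒length≤ : {xs : List (Fin n)} → Unique xs → length xs ≤ n
Unique⇒length≤ xs-unique = injective⇒≤ (Unique-lookup-injective xs-unique)

module _ {P : ℕ → Set} (P? : Decidable P) where

  Least : Set
  Least = ∃ λ d → P d × (∀ {d′} → P d′ → d ≤ d′)

  least-or-none : ∀ m → Least ⊎ (∀ {d} → d < m → ¬ P d)
  least-or-none zero = inj₂ λ ()
  least-or-none (suc m) with least-or-none m
  ... | inj₁ least = inj₁ least
  ... | inj₂ none with P? m
  ...   | yes p = inj₁ (m , p , λ p′ → ≮⇒≥ λ d′<m → none d′<m p′)
  ...   | no ¬p = inj₂ λ d<1+m → case (m<1+n⇒m<n∨m≡n d<1+m)
    where
    case : ∀ {d} → d < m ⊎ d ≡ m → ¬ P d
    case (inj₁ d<m) = none d<m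
    case (inj₂ refl) = ¬p

  least : P d → Least
  least {d} p with least-or-none (suc d)
  ... | inj₁ l = l
  ... | inj₂ none = ⊥-elim (none ≤-refl p)

SymmetricGraph : Graph n → Set
SymmetricGraph A = ∀ x y → A x y ≡ true → A y x ≡ true

_⊆ᴳ_ : Graph n → Graph n → Set
A ⊆ᴳ A′ = ∀ {x y} → A x y ≡ true → A′ x y ≡ true

⊆-augment : (E F : Graph n) → E ⊆ᴳ augment E F
⊆-augment E F {x} {y} Exy rewrite Exy = refl

augment-symmetric : (E F : Graph n) → IsUndirected E → (∀ x y → F x y ≡ F y x) →
                    SymmetricGraph (augment E F)
augment-symmetric E F (E-sym , _) F-sym x y Axy rewrite E-sym y x | F-sym y x = Axy

infixr 5 _++ʷ_

_++ʷ_ : Walk w A x y k → Walk w A y z l → Walk w A x z (k + l)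
[] ++ʷ W = W
_++ʷ_ {w = w} {A = A} {l = l} (step {x = x} {y = y} {k = k} e V) W =
  subst (Walk w A x _) (sym (+-assoc (w x y) k l)) (step e (V ++ʷ W))

edge-walk : A x y ≡ true → Walk w A x y (w x y)
edge-walk {x = x} {y = y} {w = w} e = subst (Walk w _ x y) (+-identityʳ (w x y)) (step e [])

walk-reverse : SymmetricPF w → SymmetricGraph A → Walk w A x y k → Walk w A y x k
walk-reverse w-sym A-sym [] = []
walk-reverse {w = w} {A = A} w-sym A-sym (step {x = x} {y = y} {k = k} e W) =
  subst (Walk w A _ x) (trans (cong (k +_) (w-sym y x)) (+-comm k (w x y)))
        (walk-reverse w-sym A-sym W ++ʷ edge-walk (A-sym x y e))

walk-⊆ : A ⊆ᴳ A′ → Walk w A x y k → Walk w A′ x y k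
walk-⊆ A⊆A′ [] = []
walk-⊆ A⊆A′ (step e W) = step (A⊆A′ e) (walk-⊆ A⊆A′ W)

DistLe-trans : DistLe w A x y k → DistLe w A y z l → DistLe w A x z (k + l)
DistLe-trans (_ , V , V≤k) (_ , W , W≤l) = _ , V ++ʷ W , +-mono-≤ V≤k W≤l

DistLe-sym : SymmetricPF w → SymmetricGraph A → DistLe w A x y k → DistLe w A y x k
DistLe-sym w-sym A-sym (_ , W , W≤k) = _ , walk-reverse w-sym A-sym W , W≤k

DistLe-⊆ : A ⊆ᴳ A′ → DistLe w A x y k → DistLe w A′ x y k
DistLe-⊆ A⊆A′ (_ , W , W≤k) = _ , walk-⊆ A⊆A′ W , W≤k

DistLe-weaken : k ≤ l → DistLe w A x y k → DistLe w A x y l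
DistLe-weaken k≤l (_ , W , W≤k) = _ , W , ≤-trans W≤k k≤l

geodesic-prefix : IsDist w A u p d → A p y ≡ true → Walk w A y x k →
                  IsDist w A u x (d + (w p y + k)) → IsDist w A u y (d + w p y)
geodesic-prefix {w = w} {p = p} {d = d} {y = y} {k = k} (P , _) e W (_ , x-min) =
  P ++ʷ edge-walk e ,
  λ l U → +-cancelʳ-≤ k _ _ (subst (_≤ l + k) (sym (+-assoc d (w p y) k)) (x-min _ (U ++ʷ W)))

geodesic-reroute : IsDist w A u p d → IsDist w A u y l → A p y ≡ true → Walk w A y x k →
                   IsDist w A u x (d + (w p y + k)) → IsDist w A u x (l + k)
geodesic-reroute {w = w} {A = A} {u = u} {p = p} {d = d} {y = y} {l = l} {x = x} {k = k}
                 (P , _) (Y , y-min) e W x-dist@(_ , x-min) =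
  subst (IsDist w A u x) (≤-antisym (x-min _ (Y ++ʷ W)) l+k≤) x-dist
  where
  l+k≤ : l + k ≤ d + (w p y + k)
  l+k≤ = subst (l + k ≤_) (+-assoc d (w p y) k) (+-monoˡ-≤ k (y-min _ (P ++ʷ edge-walk e)))

diameter-via-hub : SymmetricPF w → SymmetricGraph A → (∀ x → DistLe w A x u k) → DiamLe w A (k + k)
diameter-via-hub w-sym A-sym to-hub x y = DistLe-trans (to-hub x) (DistLe-sym w-sym A-sym (to-hub y))

module Distances {n : ℕ} (w : PairFun n) (A : Graph n) where
  open DecMembership (_≟ᶠ_ {n}) using (_∈?_)

  vertices : Walk w A x y k → List (Fin n)
  vertices {x = x} [] = x ∷ []
  vertices {x = x} (step _ W) = x ∷ vertices W

  SimpleWalkLe : Fin n → Fin n → ℕ → Set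
  SimpleWalkLe x y d = ∃ λ k → Σ (Walk w A x y k) λ W → k ≤ d × Unique (vertices W)

  suffix-from : (W : Walk w A y z k) → Unique (vertices W) → x ∈ vertices W → SimpleWalkLe x z k
  suffix-from [] W-unique (here refl) = _ , [] , z≤n , W-unique
  suffix-from (step e W) W-unique (here refl) = _ , step e W , ≤-refl , W-unique
  suffix-from {y = y} (step {y = y′} {k = k} _ W) (_ ∷ W-unique) (there x∈W)
    with l , V , l≤k , V-unique ← suffix-from W W-unique x∈W =
    l , V , ≤-trans l≤k (m≤n+m k (w y y′)) , V-unique

  simplify : Walk w A x y k → SimpleWalkLe x y k
  simplify [] = _ , [] , z≤n , [] ∷ []
  simplify {x = x} (step {y = y} e W) with l , V , l≤k , V-unique ← simplify W | x ∈? vertices V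
  ... | yes x∈V = let (l′ , V′ , l′≤l , V′-unique) = suffix-from V V-unique x∈V
                  in l′ , V′ , ≤-trans l′≤l (≤-trans l≤k (m≤n+m _ (w x y))) , V′-unique
  ... | no x∉V = _ , step e V , +-monoʳ-≤ (w x y) l≤k , ¬Any⇒All¬ _ x∉V ∷ V-unique

  WalkWithin : ℕ → Fin n → Fin n → ℕ → Set
  WalkWithin m x y d = ∃ λ k → Σ (Walk w A x y k) λ W → length (vertices W) ≤ m × k ≤ d

  simple⇒within : SimpleWalkLe x y d → WalkWithin n x y d
  simple⇒within (k , W , k≤d , W-unique) = k , W , Unique⇒length≤ W-unique , k≤d

  first-step : ∀ {m} → x ≢ y → WalkWithin (suc m) x y d →
               ∃ λ z → A x z ≡ true × w x z ≤ d × WalkWithin m z y (d ∸ w x z)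
  first-step x≢y (_ , [] , _ , _) = ⊥-elim (x≢y refl)
  first-step {x = x} {d = d} _ (_ , step {y = z} {k = k} e W , s≤s |W|≤m , wxz+k≤d) =
    z , e , m+n≤o⇒m≤o _ wxz+k≤d , k , W , |W|≤m , m+n≤o⇒m≤o∸n k (subst (_≤ d) (+-comm (w x z) k) wxz+k≤d)

  walkWithin? : ∀ m x y d → Dec (WalkWithin m x y d)
  walkWithin? zero x y d = no λ { (_ , [] , () , _) ; (_ , step _ _ , () , _) }
  walkWithin? (suc m) x y d with x ≟ᶠ y
  ... | yes refl = yes (0 , [] , s≤s z≤n , z≤n)
  ... | no x≢y with any? (λ z → (A x z Bool.≟ true) ×-dec (w x z ≤? d) ×-dec walkWithin? m z y (d ∸ w x z))
  ...   | yes (z , e , wxz≤d , k , W , |W|≤m , k≤d∸wxz) =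
          yes (w x z + k , step e W , s≤s |W|≤m , ≤-trans (+-monoʳ-≤ (w x z) k≤d∸wxz) (≤-reflexive (m+[n∸m]≡n wxz≤d)))
  ...   | no ¬first-step = no λ W → ¬first-step (first-step x≢y W)

  -- Walks can be made simple, so it suffices to search among walks through at most n
  -- vertices, and for those a weight bound is decidable.
  dist-exists : Walk w A x y k → ∃ (IsDist w A x y)
  dist-exists {x = x} {y = y} W
    with d , (k , V , _ , k≤d) , d-least ← least (walkWithin? n x y) (simple⇒within (simplify W)) =
    k , V , λ l U → ≤-trans k≤d (d-least (simple⇒within (simplify U)))

descend : ℕ → Fin n × ℕ → Fin n × ℕ
descend a q = proj₁ q , a + proj₂ q

root∈depths : ∀ {r} (T : Tree A r) → (r , 0) ∈ depthsT w T
root∈depths (node _ _) = here refl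

depth≤heightᵀ : ∀ {r} (T : Tree A r) → ∀ {q} → q ∈ depthsT w T → proj₂ q ≤ heightT w T
depth≤heightᶠ : ∀ {r} (f : Forest A r) → ∀ {q} → q ∈ depthsF w f → proj₂ q ≤ heightF w f
depth≤heightᵀ (node _ _) (here refl) = z≤n
depth≤heightᵀ (node _ f) (there q∈f) = depth≤heightᶠ f q∈f
depth≤heightᶠ {w = w} {r = r} (cons {ch = ch} _ t f) q∈ with ∈-++⁻ (map (descend (w r ch)) (depthsT w t)) q∈
... | inj₁ q∈t with _ , q′∈t , refl ← ∈-map⁻ (descend (w r ch)) q∈t =
  ≤-trans (+-monoʳ-≤ (w r ch) (depth≤heightᵀ t q′∈t)) (m≤m⊔n _ _)
... | inj₂ q∈f = ≤-trans (depth≤heightᶠ f q∈f) (m≤n⊔m _ _)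

heightᵀ≤ : ∀ {r M} (T : Tree A r) → (∀ {q} → q ∈ depthsT w T → proj₂ q ≤ M) → heightT w T ≤ M
heightᶠ≤ : ∀ {r M} (f : Forest A r) → (∀ {q} → q ∈ depthsF w f → proj₂ q ≤ M) → heightF w f ≤ M
heightᵀ≤ (node _ f) bound = heightᶠ≤ f (λ q∈f → bound (there q∈f))
heightᶠ≤ [] _ = z≤n
heightᶠ≤ {w = w} {r = r} {M = M} (cons {ch = ch} _ t f) bound =
  ⊔-lub (subst (_≤ M) (+-comm (heightT w t) a) (m≤o∸n⇒m+n≤o _ a≤M (heightᵀ≤ t bound-t)))
        (heightᶠ≤ f (λ q∈f → bound (∈-++⁺ʳ _ q∈f)))
  where
  a = w r ch
  bound-via-t : ∀ {q} → q ∈ depthsT w t → a + proj₂ q ≤ M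
  bound-via-t q∈t = bound (∈-++⁺ˡ (∈-map⁺ (descend a) q∈t))
  a≤M : a ≤ M
  a≤M = m+n≤o⇒m≤o a (bound-via-t (root∈depths t))
  bound-t : ∀ {q} → q ∈ depthsT w t → proj₂ q ≤ M ∸ a
  bound-t {q} q∈t = m+n≤o⇒m≤o∸n (proj₂ q) (subst (_≤ M) (+-comm a (proj₂ q)) (bound-via-t q∈t))

module Grafting {n : ℕ} (w : PairFun n) (A : Graph n) where

  graftᵀ : ∀ {r p y dp} (T : Tree A r) → (p , dp) ∈ depthsT w T → A p y ≡ true → Tree A r
  graftᶠ : ∀ {r p y dp} (f : Forest A r) → (p , dp) ∈ depthsF w f → A p y ≡ true → Forest A r
  graftᵀ {y = y} (node r f) (here refl) e = node r (cons e (node y []) f)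
  graftᵀ (node r f) (there p∈f) e = node r (graftᶠ f p∈f e)
  graftᶠ {r = r} (cons {ch = ch} e′ t f) p∈ e with ∈-++⁻ (map (descend (w r ch)) (depthsT w t)) p∈
  ... | inj₁ p∈t with _ , p′∈t , refl ← ∈-map⁻ (descend (w r ch)) p∈t = cons e′ (graftᵀ t p′∈t e) f
  ... | inj₂ p∈f = cons e′ t (graftᶠ f p∈f e)

  graftᵀ-depths : ∀ {r p y dp} (T : Tree A r) (p∈T : (p , dp) ∈ depthsT w T) (e : A p y ≡ true) →
                  depthsT w (graftᵀ T p∈T e) ↭ (y , dp + w p y) ∷ depthsT w T
  graftᶠ-depths : ∀ {r p y dp} (f : Forest A r) (p∈f : (p , dp) ∈ depthsF w f) (e : A p y ≡ true) →
                  depthsF w (graftᶠ f p∈f e) ↭ (y , dp + w p y) ∷ depthsF w f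
  graftᵀ-depths {y = y} (node r f) (here refl) e =
    ↭-trans (prep (r , 0) (↭-reflexive (cong (λ d → (y , d) ∷ depthsF w f) (+-identityʳ (w r y)))))
            (swap (r , 0) (y , w r y) ↭-refl)
  graftᵀ-depths (node r f) (there p∈f) e = ↭-trans (prep (r , 0) (graftᶠ-depths f p∈f e)) (swap (r , 0) _ ↭-refl)
  graftᶠ-depths {r = r} (cons {ch = ch} e′ t f) p∈ e with ∈-++⁻ (map (descend (w r ch)) (depthsT w t)) p∈
  graftᶠ-depths {r = r} {p = p} {y = y} (cons {ch = ch} e′ t f) p∈ e | inj₁ p∈t
    with (_ , d′) , p′∈t , refl ← ∈-map⁻ (descend (w r ch)) p∈t =
    ↭-trans (++⁺ʳ (depthsF w f) (↭-map⁺ (descend (w r ch)) (graftᵀ-depths t p′∈t e)))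
            (↭-reflexive (cong (λ d → (y , d) ∷ map (descend (w r ch)) (depthsT w t) ++ depthsF w f)
                               (sym (+-assoc (w r ch) d′ (w p y)))))
  ... | inj₂ p∈f = ↭-trans (++⁺ˡ (map (descend (w r ch)) (depthsT w t)) (graftᶠ-depths f p∈f e))
                           (shift _ (map (descend (w r ch)) (depthsT w t)) (depthsF w f))

module ShortestPathTrees {n : ℕ} (w : PairFun n) (A : Graph n) (u : Fin n) where
  open DecMembership (_≟ᶠ_ {n}) using (_∈?_)
  open Distances w A using (dist-exists)
  open Grafting w A

  verticesᵀ : Tree A u → List (Fin n)
  verticesᵀ T = map proj₁ (depthsT w T)

  IsDistanceTree : Tree A u → Set
  IsDistanceTree T = Unique (verticesᵀ T) × (∀ {q} → q ∈ depthsT w T → IsDist w A u (proj₁ q) (proj₂ q))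

  Extension : Tree A u → Fin n → ℕ → Set
  Extension T x d = Σ (Tree A u) λ T′ → IsDistanceTree T′ × depthsT w T ⊆ depthsT w T′ × (x , d) ∈ depthsT w T′

  graft-geodesic : ∀ {p q x dp k} (T : Tree A u) → IsDistanceTree T → (p , dp) ∈ depthsT w T →
                   A p q ≡ true → q ∉ verticesᵀ T → Walk w A q x k →
                   IsDist w A u x (dp + (w p q + k)) → Extension T q (dp + w p q)
  graft-geodesic T (T-unique , T-dist) p∈T e q∉T W x-dist =
    graftᵀ T p∈T e , (T₁-unique , T₁-dist) , (λ r∈T → ∈-resp-↭ (↭-sym grafted) (there r∈T)) ,
    ∈-resp-↭ (↭-sym grafted) (here refl)
    where
    grafted = graftᵀ-depths T p∈T e
    T₁-unique : Unique (verticesᵀ (graftᵀ T p∈T e))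
    T₁-unique = Unique-resp-↭ (setoid (Fin n)) (↭⇒↭ₛ (↭-sym (↭-map⁺ proj₁ grafted))) (¬Any⇒All¬ _ q∉T ∷ T-unique)
    T₁-dist : ∀ {r} → r ∈ depthsT w (graftᵀ T p∈T e) → IsDist w A u (proj₁ r) (proj₂ r)
    T₁-dist r∈T₁ with ∈-resp-↭ grafted r∈T₁
    ... | here refl = geodesic-prefix (T-dist p∈T) e W x-dist
    ... | there r∈T = T-dist r∈T

  -- Walk along a geodesic from a tree vertex: where it meets the tree, continue from the
  -- tree's copy of that vertex; elsewhere graft its next vertex.
  extend-along : ∀ {p x dp k} (T : Tree A u) → IsDistanceTree T → (p , dp) ∈ depthsT w T →
                 Walk w A p x k → IsDist w A u x (dp + k) → ∃ (Extension T x)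
  extend-along T T-dt p∈T [] _ = _ , T , T-dt , ⊆-refl , p∈T
  extend-along {p} {x} {dp} T T-dt@(_ , T-dist) p∈T (step {y = q} {k = k} e W) x-dist with q ∈? verticesᵀ T
  ... | yes q∈T with (_ , dq) , q∈depths , refl ← ∈-map⁻ proj₁ q∈T =
    extend-along T T-dt q∈depths W (geodesic-reroute (T-dist p∈T) (T-dist q∈depths) e W x-dist)
  ... | no q∉T =
    let (T₁ , T₁-dt , T⊆T₁ , q∈T₁) = graft-geodesic T T-dt p∈T e q∉T W x-dist
        (d , T′ , T′-dt , T₁⊆T′ , x∈T′) =
          extend-along T₁ T₁-dt q∈T₁ W (subst (IsDist w A u x) (sym (+-assoc dp (w p q) k)) x-dist)
    in d , T′ , T′-dt , ⊆-trans T⊆T₁ T₁⊆T′ , x∈T′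

  distanceTree-covering : (∀ x → ∃ λ k → Walk w A u x k) → (xs : List (Fin n)) →
                          Σ (Tree A u) λ T → IsDistanceTree T × (∀ {x} → x ∈ xs → ∃ λ d → (x , d) ∈ depthsT w T)
  distanceTree-covering reach [] = node u [] , ([] ∷ [] , λ { (here refl) → [] , λ _ _ → z≤n }) , λ ()
  distanceTree-covering reach (x ∷ xs)
    with T , T-dt , T-covers ← distanceTree-covering reach xs
       | _ , x-dist ← dist-exists (proj₂ (reach x))
    with d , T′ , T′-dt , T⊆T′ , x∈T′ ← extend-along T T-dt (root∈depths T) (proj₁ x-dist) x-dist =
    T′ , T′-dt , λ { (here refl) → d , x∈T′ ; (there y∈xs) → let (d′ , y∈T) = T-covers y∈xs in d′ , T⊆T′ y∈T }

SPT-of-radius : ∀ {D} (C : Subset n) → (∀ x → DistLe w A u x D) →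
                Σ (Tree A u) λ T → IsSPT w A C u T × heightT w T ≤ D
SPT-of-radius {w = w} {A = A} {u = u} C within
  with T , (T-unique , T-dist) , T-covers ←
       ShortestPathTrees.distanceTree-covering w A u (λ x → let (k , W , _) = within x in k , W) (allFin _) =
  T , (T-unique , λ x _ → let (d , x∈T) = T-covers (∈-allFin x) in d , x∈T , T-dist x∈T) ,
  heightᵀ≤ T λ q∈T → let (k , W , k≤D) = within _ in ≤-trans (proj₂ (T-dist q∈T) k W) k≤D

SPT-reach≤height : ∀ {C} {T : Tree A u} → IsSPT w A C u T → x ∈ˢ C → DistLe w A u x (heightT w T)
SPT-reach≤height {x = x} {T = T} (_ , spans) x∈C with d , x∈T , (W , _) ← spans x x∈C =
  d , W , depth≤heightᵀ T x∈T

lemma5 : ∀ {n : ℕ} (E : Graph n) (w c : PairFun n) (B : ℕ) → IsInstance E w c →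
         (C : Subset n) → ∣ C ∣ ≡ suc B →
         (D : ℕ) → IsOptDiam E w c B D →
         (∀ (v : Fin n) → DistToSetLe w E v C D) →
         (u : Fin n) (F : Graph n) → IsBAug E c B F →
         (T : Tree (augment E F) u) → IsSPT w (augment E F) C u T →
         (F₀ : Graph n) (T₀ : Tree (augment E F₀) u) → IsMinHeightSPT E w c B C u F₀ T₀ →
         heightT w T ≡ heightT w T₀ →
         DiamLe w (augment E F) (4 * D)
lemma5 E w c B (E-undirected , w-sym , _) C _ D ((F* , F*-aug , F*-diam) , _) near u F (F-sym , _)
       T T-spt F₀ T₀ (_ , _ , T₀-minimal) hT≡hT₀ x y =
  DistLe-weaken (≤-reflexive D+D+[D+D]≡4*D) (diameter-via-hub w-sym G-sym to-u x y)
  where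
  G-sym : SymmetricGraph (augment E F)
  G-sym = augment-symmetric E F E-undirected F-sym
  hT≤D : heightT w T ≤ D
  hT≤D with T* , T*-spt , hT*≤D ← SPT-of-radius C (F*-diam u) =
    subst (_≤ D) (sym hT≡hT₀) (≤-trans (T₀-minimal F* T* F*-aug T*-spt) hT*≤D)
  to-u : ∀ x → DistLe w (augment E F) x u (D + D)
  to-u x with c , c∈C , x→c ← near x =
    DistLe-trans (DistLe-⊆ (⊆-augment E F) x→c)
                 (DistLe-weaken hT≤D (DistLe-sym w-sym G-sym (SPT-reach≤height T-spt c∈C)))
  D+D+[D+D]≡4*D : (D + D) + (D + D) ≡ 4 * D
  D+D+[D+D]≡4*D = trans (+-assoc D D (D + D)) (cong (λ t → D + (D + (D + t))) (sym (+-identityʳ D)))
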